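{- For every positive integer $n$, $$\sum_{k=0}^{n-1}(3k+2)(-1)^k f_k \equiv 0 \pmod{2n^2},$$ where $f_k=\sum_{j=0}^{k}\binom{k}{j}^3$ is the $k$-th Franel number.
   Context: The Franel numbers are defined for all nonnegative integers $k$ by $f_k=\sum_{j=0}^{k}\binom{k}{j}^3$. -}

module Defs where

open import Data.Nat as ℕ using (ℕ; zero; suc)
open import Data.Nat.Combinatorics using (_C_)
open import Data.Integer as ℤ using (ℤ; +_; -_)

-- Σ_{j=0}^{n} f j  (inclusive upper bound)
sumTo : ℕ → (ℕ → ℕ) → ℕ
sumTo zero    f = f 0
sumTo (suc n) f = sumTo n f ℕ.+ f (suc n)

franel : ℕ → ℕ
franel k = sumTo k (λ j → (k C j) ℕ.^ 3)

sign : ℕ → ℤ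
sign zero    = + 1
sign (suc k) = - sign k

-- Σ_{k=0}^{n-1} g k over ℤ  (exclusive upper bound)
sumBelowℤ : ℕ → (ℕ → ℤ) → ℤ
sumBelowℤ zero    g = + 0
sumBelowℤ (suc n) g = sumBelowℤ n g ℤ.+ g n

module Submission where

-- The quotient is exhibited.  Let C_k = C(2k,k)/(k+1) (Catalan),
-- t_n(k) = C(n,k) C(k,n-k) C_k and T_n = Σ_k t_n(k) ∈ ℕ.
--  (1) Strehl: f_n = Σ_k S(n,k) with S(n,k) = C(n,k)² C(2k,n), by Vandermonde
--      convolution and an interchange of a double sum.
--  (2) WZ pair: for n ≥ 1, with the certificate h_n(k) = (2k-n)₊ S(n,k),
--        (3n+2) S(n,k) + h_n(k+1) = 2(n+1)² t_n(k) + 2n² t_{n-1}(k) + h_n(k),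
--      checked by cases on the position of k in 0..n; summing over k
--      telescopes to (3n+2) f_n = 2(n+1)² T_n + 2n² T_{n-1}.
--  (3) By induction, Σ_{k<n} (3k+2)(-1)^k f_k = (-1)^{n-1} · 2n² · T_{n-1}.

open import Defs
open import Data.Nat as ℕ
open import Data.Nat.Properties
open import Data.Nat.Combinatorics
  using (_C_; k>n⇒nCk≡0; nCn≡1; nC1≡n; nCk≡nC[n∸k]; nCk+nC[k+1]≡[n+1]C[k+1]; nCk≡n!/k![n-k]!; k![n∸k]!∣n!)
open import Data.Nat.DivMod using (m/n*n≡m)
open import Data.Nat.Tactic.RingSolver using (solve)
open import Data.List using (_∷_; [])
open import Data.Product using (_,_)
open import Relation.Nullary using (yes; no)
open import Relation.Binary.Definitions using (tri<; tri≈; tri>)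
open import Relation.Binary.PropositionalEquality
open ≡-Reasoning
import Algebra.Properties.CommutativeSemigroup as CommSemigroupProperties
open CommSemigroupProperties +-commutativeSemigroup using (x∙yz≈y∙xz; xy∙z≈xz∙y)
  renaming (interchange to +-interchange)
open CommSemigroupProperties *-commutativeSemigroup using ()
  renaming (interchange to *-interchange)

-- The library's n C k computes by cases on k ≤ᵇ n; an opaque copy keeps it
-- folded, so binomials stay atomic in goals and in ring-solver calls.
opaque
  binom : ℕ → ℕ → ℕ
  binom = _C_

opaque
  unfolding binom

  binom≡C : ∀ n k → binom n k ≡ n C k
  binom≡C n k = refl

  binom-zero : ∀ n → binom n 0 ≡ 1
  binom-zero n = refl

  binom-one : ∀ n → binom n 1 ≡ n
  binom-one = nC1≡n

  binom-diag : ∀ n → binom n n ≡ 1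
  binom-diag = nCn≡1

  binom-above : ∀ {n k} → n < k → binom n k ≡ 0
  binom-above = k>n⇒nCk≡0

  pascal : ∀ n k → binom (suc n) (suc k) ≡ binom n k + binom n (suc k)
  pascal n k = sym (nCk+nC[k+1]≡[n+1]C[k+1] n k)

  binom-sym : ∀ {n k} → k ≤ n → binom n (n ∸ k) ≡ binom n k
  binom-sym k≤n = sym (nCk≡nC[n∸k] k≤n)

  binom-factorial : ∀ m r → binom (m + r) m * (m ! * r !) ≡ (m + r) !
  binom-factorial m r = begin
    ((m + r) C m) * (m ! * r !)
      ≡⟨ cong (λ t → ((m + r) C m) * (m ! * t !)) (sym (m+n∸m≡n m r)) ⟩
    ((m + r) C m) * (m ! * (m + r ∸ m) !)
      ≡⟨ cong (_* (m ! * (m + r ∸ m) !)) (nCk≡n!/k![n-k]! (m≤m+n m r)) ⟩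
    ((m + r) ! / (m ! * (m + r ∸ m) !)) {{m !* (m + r ∸ m) !≢0}} * (m ! * (m + r ∸ m) !)
      ≡⟨ m/n*n≡m {{m !* (m + r ∸ m) !≢0}} (k![n∸k]!∣n! (m≤m+n m r)) ⟩
    (m + r) ! ∎

binom-pred : ∀ n → binom (suc n) n ≡ suc n
binom-pred n = trans (binom-sym {suc n} {1} (s≤s z≤n)) (binom-one (suc n))

binom-swap : ∀ a b → binom (a + b) a ≡ binom (a + b) b
binom-swap a b = begin
  binom (a + b) a           ≡⟨ binom-sym (m≤m+n a b) ⟨
  binom (a + b) (a + b ∸ a) ≡⟨ cong (binom (a + b)) (m+n∸m≡n a b) ⟩
  binom (a + b) b           ∎

-- Ratio identities between neighbouring binomials are proved by multiplying
-- both sides by a nonzero product of factorials and using binom-factorial.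
cancel-factorials : ∀ a b {x y} → x * (a ! * b !) ≡ y * (a ! * b !) → x ≡ y
cancel-factorials a b {x} {y} = *-cancelʳ-≡ x y (a ! * b !) {{a !* b !≢0}}

binom-absorb : ∀ k r → suc r * binom (suc (k + r)) k ≡ suc (k + r) * binom (k + r) k
binom-absorb k r = cancel-factorials k r (begin
  suc r * binom (suc (k + r)) k * (k ! * r !)
    ≡⟨ regroup (suc r) (binom (suc (k + r)) k) (k !) (r !) ⟩
  binom (suc (k + r)) k * (k ! * suc r !)
    ≡⟨ cong (λ n → binom n k * (k ! * suc r !)) (sym (+-suc k r)) ⟩
  binom (k + suc r) k * (k ! * suc r !)
    ≡⟨ binom-factorial k (suc r) ⟩
  (k + suc r) !
    ≡⟨ cong _! (+-suc k r) ⟩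
  suc (k + r) * (k + r) !
    ≡⟨ cong (suc (k + r) *_) (binom-factorial k r) ⟨
  suc (k + r) * (binom (k + r) k * (k ! * r !))
    ≡⟨ *-assoc (suc (k + r)) (binom (k + r) k) (k ! * r !) ⟨
  suc (k + r) * binom (k + r) k * (k ! * r !) ∎)
  where
  regroup : ∀ x y a b → x * y * (a * b) ≡ y * (a * (x * b))
  regroup x y a b = solve (x ∷ y ∷ a ∷ b ∷ [])

binom-lower-step : ∀ k r → suc k * binom (k + r) (suc k) ≡ r * binom (k + r) k
binom-lower-step k zero = begin
  suc k * binom (k + 0) (suc k)
    ≡⟨ cong (suc k *_) (binom-above (s≤s (≤-reflexive (+-identityʳ k)))) ⟩
  suc k * 0
    ≡⟨ *-zeroʳ (suc k) ⟩
  0 ∎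
binom-lower-step k (suc r) = cancel-factorials k r (begin
  suc k * binom (k + suc r) (suc k) * (k ! * r !)
    ≡⟨ regroup-left (suc k) (binom (k + suc r) (suc k)) (k !) (r !) ⟩
  binom (k + suc r) (suc k) * (suc k ! * r !)
    ≡⟨ cong (λ n → binom n (suc k) * (suc k ! * r !)) (+-suc k r) ⟩
  binom (suc k + r) (suc k) * (suc k ! * r !)
    ≡⟨ binom-factorial (suc k) r ⟩
  (suc k + r) !
    ≡⟨ cong _! (+-suc k r) ⟨
  (k + suc r) !
    ≡⟨ binom-factorial k (suc r) ⟨
  binom (k + suc r) k * (k ! * suc r !)
    ≡⟨ regroup-right (suc r) (binom (k + suc r) k) (k !) (r !) ⟩
  suc r * binom (k + suc r) k * (k ! * r !) ∎)
  where
  regroup-left : ∀ x y a b → x * y * (a * b) ≡ y * ((x * a) * b)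
  regroup-left x y a b = solve (x ∷ y ∷ a ∷ b ∷ [])
  regroup-right : ∀ x y a b → y * (a * (x * b)) ≡ x * y * (a * b)
  regroup-right x y a b = solve (x ∷ y ∷ a ∷ b ∷ [])

-- Trinomial revision: both sides count the splittings of a + b + c objects
-- into blocks of sizes a, b, c, i.e. both equal (a+b+c)!/(a! b! c!).
binom-trinomial : ∀ a b c →
  binom (a + b + c) (a + b) * binom (a + b) a ≡ binom (a + b + c) a * binom (b + c) b
binom-trinomial a b c =
  *-cancelʳ-≡ _ _ (a ! * (b ! * c !)) {{m*n≢0 (a !) (b ! * c !) {{a !≢0}} {{b !* c !≢0}}}}
    (trans outer-first (sym inner-first))
  where
  regroup-outer : ∀ x y p q s → x * y * (p * (q * s)) ≡ x * (y * (p * q) * s)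
  regroup-outer x y p q s = solve (x ∷ y ∷ p ∷ q ∷ s ∷ [])
  regroup-inner : ∀ x y p q s → x * y * (p * (q * s)) ≡ x * (p * (y * (q * s)))
  regroup-inner x y p q s = solve (x ∷ y ∷ p ∷ q ∷ s ∷ [])
  outer-first : binom (a + b + c) (a + b) * binom (a + b) a * (a ! * (b ! * c !)) ≡ (a + b + c) !
  outer-first = begin
    binom (a + b + c) (a + b) * binom (a + b) a * (a ! * (b ! * c !))
      ≡⟨ regroup-outer (binom (a + b + c) (a + b)) (binom (a + b) a) (a !) (b !) (c !) ⟩
    binom (a + b + c) (a + b) * (binom (a + b) a * (a ! * b !) * c !)
      ≡⟨ cong (λ t → binom (a + b + c) (a + b) * (t * c !)) (binom-factorial a b) ⟩
    binom (a + b + c) (a + b) * ((a + b) ! * c !)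
      ≡⟨ binom-factorial (a + b) c ⟩
    (a + b + c) ! ∎
  inner-first : binom (a + b + c) a * binom (b + c) b * (a ! * (b ! * c !)) ≡ (a + b + c) !
  inner-first = begin
    binom (a + b + c) a * binom (b + c) b * (a ! * (b ! * c !))
      ≡⟨ regroup-inner (binom (a + b + c) a) (binom (b + c) b) (a !) (b !) (c !) ⟩
    binom (a + b + c) a * (a ! * (binom (b + c) b * (b ! * c !)))
      ≡⟨ cong (λ t → binom (a + b + c) a * (a ! * t)) (binom-factorial b c) ⟩
    binom (a + b + c) a * (a ! * (b + c) !)
      ≡⟨ cong (λ n → binom n a * (a ! * (b + c) !)) (+-assoc a b c) ⟩
    binom (a + (b + c)) a * (a ! * (b + c) !)
      ≡⟨ binom-factorial a (b + c) ⟩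
    (a + (b + c)) !
      ≡⟨ cong _! (+-assoc a b c) ⟨
    (a + b + c) ! ∎

-- Choosing an l-set and then a disjoint j-set is symmetric in (l, j):
-- C(n,l) C(n-l,j) = C(n,j) C(n-j,l).
binom-subset-swap : ∀ n l j → l ≤ n → j ≤ n →
  binom n l * binom (n ∸ l) j ≡ binom n j * binom (n ∸ j) l
binom-subset-swap n l j l≤n j≤n with l + j ≤? n
... | no l+j≰n = begin
  binom n l * binom (n ∸ l) j ≡⟨ cong (binom n l *_) (binom-above n∸l<j) ⟩
  binom n l * 0               ≡⟨ *-zeroʳ (binom n l) ⟩
  0                           ≡⟨ *-zeroʳ (binom n j) ⟨
  binom n j * 0               ≡⟨ cong (binom n j *_) (binom-above n∸j<l) ⟨
  binom n j * binom (n ∸ j) l ∎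
  where
  n<l+j : n < l + j
  n<l+j = ≰⇒> l+j≰n
  n∸l<j : n ∸ l < j
  n∸l<j = +-cancelˡ-< l (n ∸ l) j (subst (_< l + j) (sym (m+[n∸m]≡n l≤n)) n<l+j)
  n∸j<l : n ∸ j < l
  n∸j<l = +-cancelˡ-< j (n ∸ j) l (subst₂ _<_ (sym (m+[n∸m]≡n j≤n)) (+-comm l j) n<l+j)
... | yes l+j≤n with m≤n⇒∃[o]m+o≡n l+j≤n
...   | s , refl = begin
  binom (l + j + s) l * binom (l + j + s ∸ l) j
    ≡⟨ cong (λ m → binom (l + j + s) l * binom m j) (drop l j s) ⟩
  binom (l + j + s) l * binom (j + s) j
    ≡⟨ binom-trinomial l j s ⟨
  binom (l + j + s) (l + j) * binom (l + j) l
    ≡⟨ cong (binom (l + j + s) (l + j) *_) (binom-swap l j) ⟩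
  binom (l + j + s) (l + j) * binom (l + j) j
    ≡⟨ cong (λ m → binom (m + s) m * binom m j) (+-comm l j) ⟩
  binom (j + l + s) (j + l) * binom (j + l) j
    ≡⟨ binom-trinomial j l s ⟩
  binom (j + l + s) j * binom (l + s) l
    ≡⟨ cong₂ (λ m p → binom (m + s) j * binom p l) (+-comm j l) (sym (drop j l s)) ⟩
  binom (l + j + s) j * binom (j + l + s ∸ j) l
    ≡⟨ cong (λ m → binom (l + j + s) j * binom (m + s ∸ j) l) (+-comm j l) ⟩
  binom (l + j + s) j * binom (l + j + s ∸ j) l ∎
  where
  drop : ∀ a b c → a + b + c ∸ a ≡ b + c
  drop a b c = trans (cong (_∸ a) (+-assoc a b c)) (m+n∸m≡n a (b + c))

-- C(k, n-k) C(2k, k) = C(n, k) C(2k, n) for k ≤ n (trinomial revision with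
-- blocks k, n-k, 2k-n); both vanish when n > 2k.
binom-central-revision : ∀ n k → k ≤ n →
  binom k (n ∸ k) * binom (k + k) k ≡ binom n k * binom (k + k) n
binom-central-revision n k k≤n with m≤n⇒∃[o]m+o≡n k≤n
... | b , refl with b ≤? k
...   | no b≰k = begin
  binom k (k + b ∸ k) * binom (k + k) k
    ≡⟨ cong (λ t → binom k t * binom (k + k) k) (m+n∸m≡n k b) ⟩
  binom k b * binom (k + k) k
    ≡⟨ cong (_* binom (k + k) k) (binom-above (≰⇒> b≰k)) ⟩
  0
    ≡⟨ *-zeroʳ (binom (k + b) k) ⟨
  binom (k + b) k * 0
    ≡⟨ cong (binom (k + b) k *_) (binom-above (+-monoʳ-< k (≰⇒> b≰k))) ⟨
  binom (k + b) k * binom (k + k) (k + b) ∎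
...   | yes b≤k with m≤n⇒∃[o]m+o≡n b≤k
...     | c , b+c≡k = begin
  binom k (k + b ∸ k) * binom (k + k) k
    ≡⟨ cong (λ t → binom k t * binom (k + k) k) (m+n∸m≡n k b) ⟩
  binom k b * binom (k + k) k
    ≡⟨ *-comm (binom k b) (binom (k + k) k) ⟩
  binom (k + k) k * binom k b
    ≡⟨ cong₂ (λ u v → binom u k * binom v b) 2k≡k+b+c (sym b+c≡k) ⟩
  binom (k + b + c) k * binom (b + c) b
    ≡⟨ binom-trinomial k b c ⟨
  binom (k + b + c) (k + b) * binom (k + b) k
    ≡⟨ cong (λ u → binom u (k + b) * binom (k + b) k) (sym 2k≡k+b+c) ⟩
  binom (k + k) (k + b) * binom (k + b) k
    ≡⟨ *-comm (binom (k + k) (k + b)) (binom (k + b) k) ⟩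
  binom (k + b) k * binom (k + k) (k + b) ∎
  where
  2k≡k+b+c : k + k ≡ k + b + c
  2k≡k+b+c = trans (cong (k +_) (sym b+c≡k)) (sym (+-assoc k b c))

sum-cong : ∀ n {f g : ℕ → ℕ} → (∀ k → k ≤ n → f k ≡ g k) → sumTo n f ≡ sumTo n g
sum-cong zero    f≗g = f≗g 0 z≤n
sum-cong (suc n) f≗g =
  cong₂ _+_ (sum-cong n (λ k k≤n → f≗g k (m≤n⇒m≤1+n k≤n))) (f≗g (suc n) ≤-refl)

sum-zero : ∀ n (f : ℕ → ℕ) → (∀ k → k ≤ n → f k ≡ 0) → sumTo n f ≡ 0
sum-zero zero    f f≗0 = f≗0 0 z≤n
sum-zero (suc n) f f≗0 =
  cong₂ _+_ (sum-zero n f (λ k k≤n → f≗0 k (m≤n⇒m≤1+n k≤n))) (f≗0 (suc n) ≤-refl)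

sum-+ : ∀ n (f g : ℕ → ℕ) → sumTo n (λ k → f k + g k) ≡ sumTo n f + sumTo n g
sum-+ zero    f g = refl
sum-+ (suc n) f g = begin
  sumTo n (λ k → f k + g k) + (f (suc n) + g (suc n))
    ≡⟨ cong (_+ (f (suc n) + g (suc n))) (sum-+ n f g) ⟩
  sumTo n f + sumTo n g + (f (suc n) + g (suc n))
    ≡⟨ +-interchange (sumTo n f) (sumTo n g) (f (suc n)) (g (suc n)) ⟩
  sumTo n f + f (suc n) + (sumTo n g + g (suc n)) ∎

sum-* : ∀ n c (f : ℕ → ℕ) → sumTo n (λ k → c * f k) ≡ c * sumTo n f
sum-* zero    c f = refl
sum-* (suc n) c f = begin
  sumTo n (λ k → c * f k) + c * f (suc n) ≡⟨ cong (_+ c * f (suc n)) (sum-* n c f) ⟩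
  c * sumTo n f + c * f (suc n)           ≡⟨ *-distribˡ-+ c (sumTo n f) (f (suc n)) ⟨
  c * (sumTo n f + f (suc n))             ∎

sum-swap : ∀ n m (f : ℕ → ℕ → ℕ) →
  sumTo n (λ k → sumTo m (f k)) ≡ sumTo m (λ j → sumTo n (λ k → f k j))
sum-swap zero    m f = refl
sum-swap (suc n) m f = begin
  sumTo n (λ k → sumTo m (f k)) + sumTo m (f (suc n))
    ≡⟨ cong (_+ sumTo m (f (suc n))) (sum-swap n m f) ⟩
  sumTo m (λ j → sumTo n (λ k → f k j)) + sumTo m (f (suc n))
    ≡⟨ sum-+ m (λ j → sumTo n (λ k → f k j)) (f (suc n)) ⟨
  sumTo m (λ j → sumTo n (λ k → f k j) + f (suc n) j) ∎

sum-peel : ∀ n (f : ℕ → ℕ) → sumTo (suc n) f ≡ f 0 + sumTo n (λ k → f (suc k))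
sum-peel zero    f = refl
sum-peel (suc n) f = begin
  sumTo (suc n) f + f (suc (suc n))
    ≡⟨ cong (_+ f (suc (suc n))) (sum-peel n f) ⟩
  f 0 + sumTo n (λ k → f (suc k)) + f (suc (suc n))
    ≡⟨ +-assoc (f 0) (sumTo n (λ k → f (suc k))) (f (suc (suc n))) ⟩
  f 0 + sumTo (suc n) (λ k → f (suc k)) ∎

sum-reverse : ∀ n (f : ℕ → ℕ) → sumTo n f ≡ sumTo n (λ k → f (n ∸ k))
sum-reverse zero    f = refl
sum-reverse (suc n) f = begin
  sumTo n f + f (suc n)                     ≡⟨ cong (_+ f (suc n)) (sum-reverse n f) ⟩
  sumTo n (λ k → f (n ∸ k)) + f (suc n)     ≡⟨ +-comm _ (f (suc n)) ⟩
  f (suc n) + sumTo n (λ k → f (n ∸ k))     ≡⟨ sum-peel n (λ k → f (suc n ∸ k)) ⟨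
  sumTo (suc n) (λ k → f (suc n ∸ k))       ∎

sum-tail : ∀ j d (f : ℕ → ℕ) → (∀ k → j < k → f k ≡ 0) → sumTo (j + d) f ≡ sumTo j f
sum-tail j zero    f f≗0 = cong (λ n → sumTo n f) (+-identityʳ j)
sum-tail j (suc d) f f≗0 = begin
  sumTo (j + suc d) f               ≡⟨ cong (λ n → sumTo n f) (+-suc j d) ⟩
  sumTo (j + d) f + f (suc (j + d)) ≡⟨ cong₂ _+_ (sum-tail j d f f≗0) (f≗0 _ (s≤s (m≤m+n j d))) ⟩
  sumTo j f + 0                     ≡⟨ +-identityʳ _ ⟩
  sumTo j f                         ∎

sum-telescope : ∀ n (a b h : ℕ → ℕ) → (∀ k → k ≤ n → a k + h (suc k) ≡ b k + h k) →
  sumTo n a + h (suc n) ≡ sumTo n b + h 0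
sum-telescope zero    a b h step = step 0 z≤n
sum-telescope (suc n) a b h step = begin
  sumTo n a + a (suc n) + h (suc (suc n))
    ≡⟨ +-assoc (sumTo n a) _ _ ⟩
  sumTo n a + (a (suc n) + h (suc (suc n)))
    ≡⟨ cong (sumTo n a +_) (step (suc n) ≤-refl) ⟩
  sumTo n a + (b (suc n) + h (suc n))
    ≡⟨ cong (sumTo n a +_) (+-comm (b (suc n)) (h (suc n))) ⟩
  sumTo n a + (h (suc n) + b (suc n))
    ≡⟨ +-assoc (sumTo n a) _ _ ⟨
  sumTo n a + h (suc n) + b (suc n)
    ≡⟨ cong (_+ b (suc n)) (sum-telescope n a b h (λ k k≤n → step k (m≤n⇒m≤1+n k≤n))) ⟩
  sumTo n b + h 0 + b (suc n)
    ≡⟨ xy∙z≈xz∙y (sumTo n b) (h 0) (b (suc n)) ⟩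
  sumTo n b + b (suc n) + h 0 ∎

vandermonde : ∀ a b c → sumTo c (λ i → binom a i * binom b (c ∸ i)) ≡ binom (a + b) c
vandermonde a b zero = begin
  binom a 0 * binom b 0 ≡⟨ cong₂ _*_ (binom-zero a) (binom-zero b) ⟩
  1                     ≡⟨ binom-zero (a + b) ⟨
  binom (a + b) 0       ∎
vandermonde zero b (suc c) = begin
  sumTo (suc c) (λ i → binom 0 i * binom b (suc c ∸ i))
    ≡⟨ sum-peel c _ ⟩
  binom 0 0 * binom b (suc c) + sumTo c (λ i → binom 0 (suc i) * binom b (c ∸ i))
    ≡⟨ cong₂ _+_ (cong (_* binom b (suc c)) (binom-zero 0))
         (sum-zero c _ (λ i _ → cong (_* binom b (c ∸ i)) (binom-above (s≤s z≤n)))) ⟩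
  1 * binom b (suc c) + 0
    ≡⟨ trans (+-identityʳ _) (*-identityˡ _) ⟩
  binom b (suc c) ∎
vandermonde (suc a) b (suc c) = begin
  sumTo (suc c) (λ i → binom (suc a) i * binom b (suc c ∸ i))
    ≡⟨ sum-peel c _ ⟩
  binom (suc a) 0 * binom b (suc c) + sumTo c (λ i → binom (suc a) (suc i) * binom b (c ∸ i))
    ≡⟨ cong₂ _+_ (cong (_* binom b (suc c)) (binom-zero (suc a)))
         (trans (sum-cong c pascal-term) (sum-+ c _ _)) ⟩
  1 * binom b (suc c) + (lower + upper)
    ≡⟨ x∙yz≈y∙xz (1 * binom b (suc c)) lower upper ⟩
  lower + (1 * binom b (suc c) + upper)
    ≡⟨ cong₂ _+_ (vandermonde a b c) (cong (λ t → t * binom b (suc c) + upper) (sym (binom-zero a))) ⟩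
  binom (a + b) c + (binom a 0 * binom b (suc c) + upper)
    ≡⟨ cong (binom (a + b) c +_) (sym (sum-peel c (λ i → binom a i * binom b (suc c ∸ i)))) ⟩
  binom (a + b) c + sumTo (suc c) (λ i → binom a i * binom b (suc c ∸ i))
    ≡⟨ cong (binom (a + b) c +_) (vandermonde a b (suc c)) ⟩
  binom (a + b) c + binom (a + b) (suc c)
    ≡⟨ pascal (a + b) c ⟨
  binom (suc a + b) (suc c) ∎
  where
  lower = sumTo c (λ i → binom a i * binom b (c ∸ i))
  upper = sumTo c (λ i → binom a (suc i) * binom b (c ∸ i))
  pascal-term : ∀ i → i ≤ c → binom (suc a) (suc i) * binom b (c ∸ i)
                            ≡ binom a i * binom b (c ∸ i) + binom a (suc i) * binom b (c ∸ i)
  pascal-term i _ = trans (cong (_* binom b (c ∸ i)) (pascal a i))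
                          (*-distribʳ-+ (binom b (c ∸ i)) (binom a i) (binom a (suc i)))

strehl : ℕ → ℕ → ℕ
strehl n k = binom n k * binom n k * binom (k + k) n

-- Expanding C(2(n-l), n) by Vandermonde gives a double sum over (l, j); this is
-- its summand rewritten so that the sum over l can be done first.
strehl-double-sum : ∀ n l j → l ≤ n → j ≤ n →
  binom n l * binom n l * (binom (n ∸ l) j * binom (n ∸ l) (n ∸ j))
  ≡ binom n j * binom n j * (binom (n ∸ j) l * binom j l)
strehl-double-sum n l j l≤n j≤n = begin
  binom n l * binom n l * (binom (n ∸ l) j * binom (n ∸ l) (n ∸ j))
    ≡⟨ *-interchange (binom n l) (binom n l) (binom (n ∸ l) j) (binom (n ∸ l) (n ∸ j)) ⟩
  (binom n l * binom (n ∸ l) j) * (binom n l * binom (n ∸ l) (n ∸ j))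
    ≡⟨ cong₂ _*_ (binom-subset-swap n l j l≤n j≤n) (binom-subset-swap n l (n ∸ j) l≤n (m∸n≤m n j)) ⟩
  (binom n j * binom (n ∸ j) l) * (binom n (n ∸ j) * binom (n ∸ (n ∸ j)) l)
    ≡⟨ cong₂ (λ c m → (binom n j * binom (n ∸ j) l) * (c * binom m l)) (binom-sym j≤n) (m∸[m∸n]≡n j≤n) ⟩
  (binom n j * binom (n ∸ j) l) * (binom n j * binom j l)
    ≡⟨ *-interchange (binom n j) (binom (n ∸ j) l) (binom n j) (binom j l) ⟩
  binom n j * binom n j * (binom (n ∸ j) l * binom j l) ∎

-- Σ_l C(n-j, l) C(j, l) = C(n, j): Vandermonde after reflecting C(j, l).
vandermonde-squares : ∀ n j → j ≤ n → sumTo n (λ l → binom (n ∸ j) l * binom j l) ≡ binom n j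
vandermonde-squares n j j≤n with m≤n⇒∃[o]m+o≡n j≤n
... | d , refl = begin
  sumTo (j + d) (λ l → binom (j + d ∸ j) l * binom j l)
    ≡⟨ sum-tail j d _ (λ l j<l → trans (cong (binom (j + d ∸ j) l *_) (binom-above j<l))
                                      (*-zeroʳ (binom (j + d ∸ j) l))) ⟩
  sumTo j (λ l → binom (j + d ∸ j) l * binom j l)
    ≡⟨ sum-cong j (λ l l≤j → cong (binom (j + d ∸ j) l *_) (sym (binom-sym l≤j))) ⟩
  sumTo j (λ l → binom (j + d ∸ j) l * binom j (j ∸ l))
    ≡⟨ vandermonde (j + d ∸ j) j j ⟩
  binom (j + d ∸ j + j) j
    ≡⟨ cong (λ m → binom (m + j) j) (m+n∸m≡n j d) ⟩
  binom (d + j) j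
    ≡⟨ cong (λ m → binom m j) (+-comm d j) ⟩
  binom (j + d) j ∎

franel-strehl : ∀ n → franel n ≡ sumTo n (strehl n)
franel-strehl n = sym (begin
  sumTo n (strehl n)
    ≡⟨ sum-reverse n (strehl n) ⟩
  sumTo n (λ l → strehl n (n ∸ l))
    ≡⟨ sum-cong n (λ l l≤n → cong₂ (λ c s → c * c * s) (binom-sym l≤n) (sym (vandermonde (n ∸ l) (n ∸ l) n))) ⟩
  sumTo n (λ l → binom n l * binom n l * sumTo n (λ j → binom (n ∸ l) j * binom (n ∸ l) (n ∸ j)))
    ≡⟨ sum-cong n (λ l _ → sym (sum-* n (binom n l * binom n l) _)) ⟩
  sumTo n (λ l → sumTo n (λ j → binom n l * binom n l * (binom (n ∸ l) j * binom (n ∸ l) (n ∸ j))))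
    ≡⟨ sum-cong n (λ l l≤n → sum-cong n (λ j j≤n → strehl-double-sum n l j l≤n j≤n)) ⟩
  sumTo n (λ l → sumTo n (λ j → binom n j * binom n j * (binom (n ∸ j) l * binom j l)))
    ≡⟨ sum-swap n n _ ⟩
  sumTo n (λ j → sumTo n (λ l → binom n j * binom n j * (binom (n ∸ j) l * binom j l)))
    ≡⟨ sum-cong n (λ j j≤n → trans (sum-* n (binom n j * binom n j) _)
                                   (cong (binom n j * binom n j *_) (vandermonde-squares n j j≤n))) ⟩
  sumTo n (λ j → binom n j * binom n j * binom n j)
    ≡⟨ sum-cong n (λ j _ → trans (cube (binom n j)) (cong (_^ 3) (binom≡C n j))) ⟩
  franel n ∎)
  where
  cube : ∀ x → x * x * x ≡ x ^ 3
  cube x = trans (*-assoc x x x) (cong (λ y → x * (x * y)) (sym (*-identityʳ x)))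

strehl-below : ∀ {n k} → k + k < n → strehl n k ≡ 0
strehl-below {n} {k} 2k<n = trans (cong (binom n k * binom n k *_) (binom-above 2k<n))
                                  (*-zeroʳ (binom n k * binom n k))

strehl-above : ∀ {n k} → n < k → strehl n k ≡ 0
strehl-above {n} {k} n<k = cong (λ c → c * binom n k * binom (k + k) n) (binom-above n<k)

-- C_k = C(2k,k) - C(2k,k+1), characterised by (k+1) C_k = C(2k,k).
catalan : ℕ → ℕ
catalan k = binom (k + k) k ∸ binom (k + k) (suc k)

catalan-spec : ∀ k → suc k * catalan k ≡ binom (k + k) k
catalan-spec k = begin
  suc k * (binom (k + k) k ∸ binom (k + k) (suc k))
    ≡⟨ *-distribˡ-∸ (suc k) (binom (k + k) k) (binom (k + k) (suc k)) ⟩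
  suc k * binom (k + k) k ∸ suc k * binom (k + k) (suc k)
    ≡⟨ cong (suc k * binom (k + k) k ∸_) (binom-lower-step k k) ⟩
  binom (k + k) k + k * binom (k + k) k ∸ k * binom (k + k) k
    ≡⟨ m+n∸n≡m (binom (k + k) k) (k * binom (k + k) k) ⟩
  binom (k + k) k ∎

-- t_n(k) = C(n,k) C(k,n-k) C_k and T_n = Σ_{k ≤ n} t_n(k): the quotient in the
-- closed form of the alternating sum.
T-term : ℕ → ℕ → ℕ
T-term n k = binom n k * binom k (n ∸ k) * catalan k

T : ℕ → ℕ
T n = sumTo n (T-term n)

-- (k+1) t_n(k) = S(n,k) for k ≤ n + 1, by the central revision identity (for
-- k = n + 1 both sides vanish).
T-term-spec : ∀ n k → k ≤ suc n → suc k * T-term n k ≡ strehl n k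
T-term-spec n k k≤n+1 with m≤n⇒∃[o]m+o≡n k≤n+1
... | zero , k+0≡n+1 = begin
  suc k * (binom n k * binom k (n ∸ k) * catalan k)
    ≡⟨ cong (λ c → suc k * (c * binom k (n ∸ k) * catalan k)) (binom-above n<k) ⟩
  suc k * 0
    ≡⟨ *-zeroʳ (suc k) ⟩
  0
    ≡⟨ strehl-above n<k ⟨
  strehl n k ∎
  where
  n<k : n < k
  n<k = ≤-reflexive (trans (sym k+0≡n+1) (+-identityʳ k))
... | suc o , k+1+o≡n+1 = begin
  suc k * (binom n k * binom k (n ∸ k) * catalan k)
    ≡⟨ regroup (suc k) (binom n k) (binom k (n ∸ k)) (catalan k) ⟩
  binom n k * (binom k (n ∸ k) * (suc k * catalan k))
    ≡⟨ cong (λ c → binom n k * (binom k (n ∸ k) * c)) (catalan-spec k) ⟩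
  binom n k * (binom k (n ∸ k) * binom (k + k) k)
    ≡⟨ cong (binom n k *_) (binom-central-revision n k k≤n) ⟩
  binom n k * (binom n k * binom (k + k) n)
    ≡⟨ *-assoc (binom n k) (binom n k) (binom (k + k) n) ⟨
  strehl n k ∎
  where
  k≤n : k ≤ n
  k≤n = subst (k ≤_) (suc-injective (trans (sym (+-suc k o)) k+1+o≡n+1)) (m≤m+n k o)
  regroup : ∀ x a b c → x * (a * b * c) ≡ a * (b * (x * c))
  regroup x a b c = solve (x ∷ a ∷ b ∷ c ∷ [])

-- The k-th WZ equation at n, multiplied by k + 1, for abstract values
-- X = S(n,k), Y = S(n,k+1), Z = S(n-1,k), c = (2k+2-n)₊, e = (2k-n)₊:
--   (k+1)((3n+2) X + c Y) = 2(n+1)² X + 2n² Z + (k+1) e X.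
-- It is a record so that its parameters are recovered by unification.
record WZ-relation (n k X Y Z c e : ℕ) : Set where
  constructor wz
  field
    relation : suc k * ((3 * n + 2) * X + c * Y) ≡ 2 * (suc n * suc n) * X + 2 * (n * n) * Z + suc k * (e * X)

-- The relation is checked separately in the four regions of k (see Position);
-- in each, a few facts about X, Y, Z, c, e close it by algebra.
wz-below : ∀ n k {X Y Z c e} → X ≡ 0 → Z ≡ 0 → c ≡ 0 → WZ-relation n k X Y Z c e
wz-below n k {Y = Y} {e = e} refl refl refl = wz (solve (n ∷ k ∷ Y ∷ e ∷ []))

wz-top : ∀ n {X Y Z c e} → Y ≡ 0 → Z ≡ 0 → e ≡ n → WZ-relation n n X Y Z c e
wz-top n {X} {c = c} refl refl refl = wz (solve (n ∷ X ∷ c ∷ []))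

wz-boundary : ∀ k {X Y Z c e} x z → X ≡ 0 → c ≡ 1 → Y ≡ x * x * suc (suc (k + k)) → Z ≡ z * z →
  suc k * x ≡ suc (k + k) * z → WZ-relation (suc (k + k)) k X Y Z c e
wz-boundary k {e = e} x z refl refl refl refl absorb = wz (begin
  suc k * ((3 * suc (k + k) + 2) * 0 + 1 * (x * x * suc (suc (k + k))))
    ≡⟨ solve (k ∷ x ∷ []) ⟩
  2 * ((suc k * x) * (suc k * x))
    ≡⟨ cong (λ t → 2 * (t * t)) absorb ⟩
  2 * ((suc (k + k) * z) * (suc (k + k) * z))
    ≡⟨ solve (k ∷ z ∷ e ∷ []) ⟩
  2 * (suc (suc (k + k)) * suc (suc (k + k))) * 0 + 2 * (suc (k + k) * suc (k + k)) * (z * z)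
    + suc k * (e * 0) ∎)

inside-gap : ∀ {i j k n} → n ≡ k + suc i → k + k ≡ n + j → k ≡ suc (i + j)
inside-gap {i} {j} {k} n≡k+1+i 2k≡n+j =
  +-cancelˡ-≡ k k (suc (i + j)) (trans 2k≡n+j (trans (cong (_+ j) n≡k+1+i) (+-assoc k (suc i) j)))

-- The polynomial identity behind the inside case, after clearing denominators.
wz-coefficients : ∀ i j k n → k ≡ suc (i + j) → n ≡ suc (k + i) →
  suc k * suc k * suc j * (3 * n + 2) + suc i * suc i * (suc (suc (k + k)) * suc (k + k))
  ≡ 2 * (suc n * suc n) * (suc k * suc j) + suc k * suc k * suc j * j + 2 * n * suc k * (suc i * suc i)
wz-coefficients i j _ _ refl refl = solve (i ∷ j ∷ [])

-- Inside case: given the hypergeometric ratios Y : X and Z : X, multiply the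
-- relation by (k+1)(j+1) and reduce it to wz-coefficients.
wz-generic : ∀ i j k n {X Y Z c e} → n ≡ k + suc i → k + k ≡ n + j → c ≡ suc (suc j) → e ≡ j →
  suc k * suc k * (suc (suc j) * suc j) * Y ≡ suc i * suc i * (suc (suc (k + k)) * suc (k + k)) * X →
  n * suc j * Z ≡ suc i * suc i * X →
  WZ-relation n k X Y Z c e
wz-generic i j k n {X} {Y} {Z} n≡k+1+i 2k≡n+j refl refl ratio-k ratio-n =
  wz (*-cancelʳ-≡ _ _ (suc k * suc j) (begin
    suc k * ((3 * n + 2) * X + suc (suc j) * Y) * (suc k * suc j)
      ≡⟨ solve (k ∷ n ∷ j ∷ X ∷ Y ∷ []) ⟩
    suc k * suc k * suc j * (3 * n + 2) * X + suc k * suc k * (suc (suc j) * suc j) * Y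
      ≡⟨ cong (suc k * suc k * suc j * (3 * n + 2) * X +_) ratio-k ⟩
    suc k * suc k * suc j * (3 * n + 2) * X + suc i * suc i * (suc (suc (k + k)) * suc (k + k)) * X
      ≡⟨ *-distribʳ-+ X (suc k * suc k * suc j * (3 * n + 2)) _ ⟨
    (suc k * suc k * suc j * (3 * n + 2) + suc i * suc i * (suc (suc (k + k)) * suc (k + k))) * X
      ≡⟨ cong (_* X) (wz-coefficients i j k n (inside-gap n≡k+1+i 2k≡n+j) (trans n≡k+1+i (+-suc k i))) ⟩
    (2 * (suc n * suc n) * (suc k * suc j) + suc k * suc k * suc j * j + 2 * n * suc k * (suc i * suc i)) * X
      ≡⟨ solve (k ∷ n ∷ j ∷ i ∷ X ∷ []) ⟩
    (2 * (suc n * suc n) * (suc k * suc j) + suc k * suc k * suc j * j) * X + 2 * n * suc k * (suc i * suc i * X)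
      ≡⟨ cong ((2 * (suc n * suc n) * (suc k * suc j) + suc k * suc k * suc j * j) * X +_)
              (cong (2 * n * suc k *_) (sym ratio-n)) ⟩
    (2 * (suc n * suc n) * (suc k * suc j) + suc k * suc k * suc j * j) * X + 2 * n * suc k * (n * suc j * Z)
      ≡⟨ solve (k ∷ n ∷ j ∷ X ∷ Z ∷ []) ⟩
    (2 * (suc n * suc n) * X + 2 * (n * n) * Z + suc k * (j * X)) * (suc k * suc j) ∎))

data Position (n k : ℕ) : Set where
  below    : suc (k + k) < n → Position n k
  boundary : n ≡ suc (k + k) → Position n k
  inside   : ∀ i j → n ≡ k + suc i → k + k ≡ n + j → Position n k
  top      : k ≡ n → Position n k

position : ∀ n k → k ≤ n → Position n k
position n k k≤n with <-cmp (suc (k + k)) n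
... | tri< 2k+1<n _ _ = below 2k+1<n
... | tri≈ _ 2k+1≡n _ = boundary (sym 2k+1≡n)
... | tri> _ _ n<2k+1 with m≤n⇒∃[o]m+o≡n k≤n | m≤n⇒∃[o]m+o≡n (≤-pred n<2k+1)
...   | zero  , k+0≡n  | _          = top (trans (sym (+-identityʳ k)) k+0≡n)
...   | suc i , k+1+i≡n | j , n+j≡2k = inside i j (sym k+1+i≡n) (sym n+j≡2k)

double-suc : ∀ k → suc k + suc k ≡ suc (suc (k + k))
double-suc k = cong suc (+-suc k k)

ratio-combine-k : ∀ {K I J₁ J₂ N₁ N₂ x x′ y y′ y″ : ℕ} →
  K * x′ ≡ I * x → J₁ * y′ ≡ N₁ * y → J₂ * y″ ≡ N₂ * y′ →
  K * K * (J₂ * J₁) * (x′ * x′ * y″) ≡ I * I * (N₂ * N₁) * (x * x * y)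
ratio-combine-k {K} {I} {J₁} {J₂} {N₁} {N₂} {x} {x′} {y} {y′} {y″} hx hy′ hy″ = begin
  K * K * (J₂ * J₁) * (x′ * x′ * y″)   ≡⟨ solve (K ∷ J₁ ∷ J₂ ∷ x′ ∷ y″ ∷ []) ⟩
  (K * x′) * (K * x′) * J₁ * (J₂ * y″) ≡⟨ cong₂ (λ a b → a * a * J₁ * b) hx hy″ ⟩
  (I * x) * (I * x) * J₁ * (N₂ * y′)   ≡⟨ solve (I ∷ x ∷ J₁ ∷ N₂ ∷ y′ ∷ []) ⟩
  (I * x) * (I * x) * N₂ * (J₁ * y′)   ≡⟨ cong ((I * x) * (I * x) * N₂ *_) hy′ ⟩
  (I * x) * (I * x) * N₂ * (N₁ * y)    ≡⟨ solve (I ∷ x ∷ N₁ ∷ N₂ ∷ y ∷ []) ⟩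
  I * I * (N₂ * N₁) * (x * x * y)      ∎

ratio-combine-n : ∀ {I N J x z y w : ℕ} → I * x ≡ N * z → N * y ≡ J * w →
  N * J * (z * z * w) ≡ I * I * (x * x * y)
ratio-combine-n {I} {N} {J} {x} {z} {y} {w} hx hy = begin
  N * J * (z * z * w)         ≡⟨ solve (N ∷ J ∷ z ∷ w ∷ []) ⟩
  (N * z) * z * (J * w)       ≡⟨ cong ((N * z) * z *_) hy ⟨
  (N * z) * z * (N * y)       ≡⟨ solve (N ∷ z ∷ y ∷ []) ⟩
  (N * z) * (N * z) * y       ≡⟨ cong (λ a → a * a * y) hx ⟨
  (I * x) * (I * x) * y       ≡⟨ solve (I ∷ x ∷ y ∷ []) ⟩
  I * I * (x * x * y)         ∎

strehl-ratio-k : ∀ i j k n → n ≡ k + suc i → k + k ≡ n + j →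
  suc k * suc k * (suc (suc j) * suc j) * strehl n (suc k)
  ≡ suc i * suc i * (suc (suc (k + k)) * suc (k + k)) * strehl n k
strehl-ratio-k i j k n n≡k+1+i 2k≡n+j =
  ratio-combine-k {suc k} {suc i} {suc j} {suc (suc j)} {suc (k + k)} {suc (suc (k + k))}
    {binom n k} {binom n (suc k)} {binom (k + k) n} {binom (suc (k + k)) n} {binom (suc k + suc k) n}
  (subst (λ N → suc k * binom N (suc k) ≡ suc i * binom N k) (sym n≡k+1+i) (binom-lower-step k (suc i)))
  (subst (λ N → suc j * binom (suc N) n ≡ suc N * binom N n) (sym 2k≡n+j) (binom-absorb n j))
  (subst (λ N → suc (suc j) * binom N n ≡ suc (suc (k + k)) * binom (suc (k + k)) n) (sym (double-suc k))
    (subst (λ N → suc (suc j) * binom (suc N) n ≡ suc N * binom N n) n+1+j≡2k+1 (binom-absorb n (suc j))))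
  where
  n+1+j≡2k+1 : n + suc j ≡ suc (k + k)
  n+1+j≡2k+1 = trans (+-suc n j) (cong suc (sym 2k≡n+j))

strehl-ratio-n : ∀ i j k m → suc m ≡ k + suc i → k + k ≡ suc m + j →
  suc m * suc j * strehl m k ≡ suc i * suc i * strehl (suc m) k
strehl-ratio-n i j k m n≡k+1+i 2k≡n+j =
  ratio-combine-n {suc i} {suc m} {suc j}
    {binom (suc m) k} {binom m k} {binom (k + k) (suc m)} {binom (k + k) m}
  (subst (λ M → suc i * binom (suc M) k ≡ suc M * binom M k) (sym m≡k+i) (binom-absorb k i))
  (subst (λ N → suc m * binom N (suc m) ≡ suc j * binom N m) m+1+j≡2k (binom-lower-step m (suc j)))
  where
  m≡k+i : m ≡ k + i
  m≡k+i = suc-injective (trans n≡k+1+i (+-suc k i))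
  m+1+j≡2k : m + suc j ≡ k + k
  m+1+j≡2k = trans (+-suc m j) (sym 2k≡n+j)

strehl-wz : ∀ m k → k ≤ suc m →
  WZ-relation (suc m) k (strehl (suc m) k) (strehl (suc m) (suc k)) (strehl m k)
              (suc k + suc k ∸ suc m) (k + k ∸ suc m)
strehl-wz m k k≤n with position (suc m) k k≤n
... | below 2k+1<n =
  wz-below (suc m) k (strehl-below (<-trans (n<1+n (k + k)) 2k+1<n)) (strehl-below (≤-pred 2k+1<n))
    (m≤n⇒m∸n≡0 (subst (_≤ suc m) (sym (double-suc k)) 2k+1<n))
... | boundary refl =
  wz-boundary k (binom (suc (k + k)) (suc k)) (binom (k + k) k)
    (strehl-below (n<1+n (k + k)))
    (trans (cong (_∸ suc (k + k)) (double-suc k)) (m+n∸n≡m 1 (suc (k + k))))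
    (cong (binom (suc (k + k)) (suc k) * binom (suc (k + k)) (suc k) *_)
      (trans (cong (λ N → binom N (suc (k + k))) (double-suc k)) (binom-pred (suc (k + k)))))
    (trans (cong (binom (k + k) k * binom (k + k) k *_) (binom-diag (k + k)))
           (*-identityʳ (binom (k + k) k * binom (k + k) k)))
    (trans (cong (suc k *_) (binom-swap (suc k) k)) (binom-absorb k k))
... | top refl =
  wz-top (suc m) (strehl-above (n<1+n (suc m))) (strehl-above (n<1+n m)) (m+n∸n≡m (suc m) (suc m))
... | inside i j n≡k+1+i 2k≡n+j =
  wz-generic i j k (suc m) n≡k+1+i 2k≡n+j c≡j+2 e≡j
    (strehl-ratio-k i j k (suc m) n≡k+1+i 2k≡n+j) (strehl-ratio-n i j k m n≡k+1+i 2k≡n+j)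
  where
  e≡j : k + k ∸ suc m ≡ j
  e≡j = trans (cong (_∸ suc m) 2k≡n+j) (m+n∸m≡n (suc m) j)
  c≡j+2 : suc k + suc k ∸ suc m ≡ suc (suc j)
  c≡j+2 = begin
    suc k + suc k ∸ suc m             ≡⟨ cong (_∸ suc m) (double-suc k) ⟩
    suc (suc (k + k)) ∸ suc m         ≡⟨ cong (λ t → suc (suc t) ∸ suc m) 2k≡n+j ⟩
    suc (suc (suc m + j)) ∸ suc m     ≡⟨ cong (_∸ suc m) (sym (trans (+-suc (suc m) (suc j)) (cong suc (+-suc (suc m) j)))) ⟩
    suc m + suc (suc j) ∸ suc m       ≡⟨ m+n∸m≡n (suc m) (suc (suc j)) ⟩
    suc (suc j)                       ∎

certificate : ℕ → ℕ → ℕ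
certificate n k = (k + k ∸ n) * strehl n k

-- Dividing the WZ relation by k + 1 (using (k+1) t_n(k) = S(n,k)) gives the
-- telescoping step.
telescoping-step : ∀ m k → k ≤ suc m →
  (3 * suc m + 2) * strehl (suc m) k + certificate (suc m) (suc k)
  ≡ (2 * (suc (suc m) * suc (suc m)) * T-term (suc m) k + 2 * (suc m * suc m) * T-term m k)
    + certificate (suc m) k
telescoping-step m k k≤n = *-cancelˡ-≡ _ _ (suc k) (begin
  suc k * ((3 * n + 2) * strehl n k + certificate n (suc k))
    ≡⟨ WZ-relation.relation (strehl-wz m k k≤n) ⟩
  P * strehl n k + Q * strehl m k + suc k * certificate n k
    ≡⟨ cong₂ (λ x z → P * x + Q * z + suc k * certificate n k)
         (sym (T-term-spec n k (m≤n⇒m≤1+n k≤n))) (sym (T-term-spec m k k≤n)) ⟩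
  P * (suc k * T-term n k) + Q * (suc k * T-term m k) + suc k * certificate n k
    ≡⟨ factor-out (suc k) P Q (T-term n k) (T-term m k) (certificate n k) ⟩
  suc k * ((P * T-term n k + Q * T-term m k) + certificate n k) ∎)
  where
  n = suc m
  P = 2 * (suc n * suc n)
  Q = 2 * (n * n)
  factor-out : ∀ K P Q x z h → P * (K * x) + Q * (K * z) + K * h ≡ K * ((P * x + Q * z) + h)
  factor-out K P Q x z h = solve (K ∷ P ∷ Q ∷ x ∷ z ∷ h ∷ [])

-- (3n+2) f_n = 2(n+1)² T_n + 2n² T_{n-1} for n ≥ 1: sum the telescoping step
-- over k ≤ n; both boundary certificates vanish, and the extra term t_{n-1}(n) is 0.
franel-recurrence : ∀ m →
  (3 * suc m + 2) * franel (suc m) ≡ 2 * (suc (suc m) * suc (suc m)) * T (suc m) + 2 * (suc m * suc m) * T m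
franel-recurrence m = begin
  (3 * n + 2) * franel n
    ≡⟨ cong ((3 * n + 2) *_) (franel-strehl n) ⟩
  (3 * n + 2) * sumTo n (strehl n)
    ≡⟨ sum-* n (3 * n + 2) (strehl n) ⟨
  sumTo n a
    ≡⟨ +-identityʳ (sumTo n a) ⟨
  sumTo n a + 0
    ≡⟨ cong (sumTo n a +_) certificate-vanishes ⟨
  sumTo n a + certificate n (suc n)
    ≡⟨ sum-telescope n a b (certificate n) (telescoping-step m) ⟩
  sumTo n b + 0
    ≡⟨ +-identityʳ (sumTo n b) ⟩
  sumTo n b
    ≡⟨ sum-+ n (λ k → P * T-term n k) (λ k → Q * T-term m k) ⟩
  sumTo n (λ k → P * T-term n k) + sumTo n (λ k → Q * T-term m k)
    ≡⟨ cong₂ _+_ (sum-* n P (T-term n)) (sum-* n Q (T-term m)) ⟩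
  P * T n + Q * sumTo n (T-term m)
    ≡⟨ cong (λ t → P * T n + Q * t) T-extra-term ⟩
  P * T n + Q * T m ∎
  where
  n = suc m
  P = 2 * (suc n * suc n)
  Q = 2 * (n * n)
  a b : ℕ → ℕ
  a k = (3 * n + 2) * strehl n k
  b k = P * T-term n k + Q * T-term m k
  certificate-vanishes : certificate n (suc n) ≡ 0
  certificate-vanishes = trans (cong ((suc n + suc n ∸ n) *_) (strehl-above (n<1+n n)))
                               (*-zeroʳ (suc n + suc n ∸ n))
  T-extra-term : sumTo n (T-term m) ≡ T m
  T-extra-term = trans (cong (T m +_) (cong (λ c → c * binom n (m ∸ n) * catalan n) (binom-above (n<1+n m))))
                       (+-identityʳ (T m))

-- ℤ is imported only now: its prefix +_ would make sections such as (k +_) on ℕ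
-- ambiguous in the preceding development.
open import Data.Integer as ℤ using (ℤ; +_; -_)
open import Data.Integer.Properties using (pos-*; pos-+)
open import Data.Integer.Divisibility using (_∣_)
import Data.Integer.Divisibility.Signed as Signed
open import Data.Integer.Tactic.RingSolver using () renaming (solve to solveℤ)

alternating-term : ℕ → ℤ
alternating-term k = (+ (3 * k + 2)) ℤ.* sign k ℤ.* (+ franel k)

T-zero : T 0 ≡ 1
T-zero = cong₂ (λ c d → c * c * (c ∸ d)) (binom-zero 0) (binom-above (s≤s z≤n))

alternating-step : ∀ s P a f R → a ℤ.* f ≡ R ℤ.+ P → s ℤ.* P ℤ.+ a ℤ.* (- s) ℤ.* f ≡ - s ℤ.* R
alternating-step s P a f R af≡R+P = begin
  s ℤ.* P ℤ.+ a ℤ.* (- s) ℤ.* f   ≡⟨ solveℤ (s ∷ P ∷ a ∷ f ∷ []) ⟩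
  s ℤ.* P ℤ.- s ℤ.* (a ℤ.* f)     ≡⟨ cong (λ t → s ℤ.* P ℤ.- s ℤ.* t) af≡R+P ⟩
  s ℤ.* P ℤ.- s ℤ.* (R ℤ.+ P)     ≡⟨ solveℤ (s ∷ P ∷ R ∷ []) ⟩
  - s ℤ.* R                       ∎

alternating-closed-form : ∀ m →
  sumBelowℤ (suc m) alternating-term ≡ sign m ℤ.* (+ (2 * (suc m * suc m) * T m))
alternating-closed-form zero = cong (λ t → sign 0 ℤ.* (+ (2 * (1 * 1) * t))) (sym T-zero)
alternating-closed-form (suc m) = begin
  sumBelowℤ (suc m) alternating-term ℤ.+ alternating-term (suc m)
    ≡⟨ cong (ℤ._+ alternating-term (suc m)) (alternating-closed-form m) ⟩
  sign m ℤ.* P ℤ.+ (+ (3 * suc m + 2)) ℤ.* (- sign m) ℤ.* (+ franel (suc m))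
    ≡⟨ alternating-step (sign m) P (+ (3 * suc m + 2)) (+ franel (suc m)) R recurrence ⟩
  - sign m ℤ.* R ∎
  where
  P = + (2 * (suc m * suc m) * T m)
  R = + (2 * (suc (suc m) * suc (suc m)) * T (suc m))
  recurrence : (+ (3 * suc m + 2)) ℤ.* (+ franel (suc m)) ≡ R ℤ.+ P
  recurrence = trans (sym (pos-* (3 * suc m + 2) (franel (suc m))))
                     (trans (cong +_ (franel-recurrence m))
                            (pos-+ (2 * (suc (suc m) * suc (suc m)) * T (suc m)) (2 * (suc m * suc m) * T m)))

theorem1p1 : (n : ℕ) → ℕ.NonZero n →
    (+ (2 ℕ.* n ℕ.* n)) ∣ sumBelowℤ n (λ k → (+ (3 ℕ.* k ℕ.+ 2)) ℤ.* sign k ℤ.* (+ franel k))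
theorem1p1 (suc m) _ = Signed.∣⇒∣ᵤ (subst (+ (2 * suc m * suc m) Signed.∣_) (sym closed-form)
                         (Signed.∣n⇒∣m*n (sign m) (Signed.∣m⇒∣m*n (+ T m) Signed.∣-refl)))
  where
  closed-form : sumBelowℤ (suc m) alternating-term ≡ sign m ℤ.* (+ (2 * suc m * suc m) ℤ.* + T m)
  closed-form = trans (alternating-closed-form m)
    (cong (sign m ℤ.*_) (trans (cong (λ c → + (c * T m)) (sym (*-assoc 2 (suc m) (suc m))))
                               (pos-* (2 * suc m * suc m) (T m))))
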